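{- Let $x\neq 0$ be a complex number and let $(r_n)_{n\ge 0}$ be defined by $r_0=0$, $r_1=1$, $r_2=2x$ and $r_n=2x\,r_{n-1}+r_{n-3}$ for $n\ge 3$. Let $t$ be a complex number with $x^3(1-t)^2(1+t)=-1$ and $t\notin\{ -\tfrac13,\tfrac53\}$, and let $W$ be a square root of $(1+t)(5-3t)$. Put $$w_1=1-t,\qquad w_2=\frac{1+t-W}{2},\qquad w_3=\frac{1+t+W}{2},$$ $$A=-\frac{1}{1+3t},\qquad B=\frac{1}{2(1+3t)}-\frac{3}{2}\,\frac{W}{(5-3t)(1+3t)},\qquad C=\frac{1}{2(1+3t)}+\frac{3}{2}\,\frac{W}{(5-3t)(1+3t)}.$$ Then for all $n\ge 0$, $$r_n=x^{n-1}\big(A w_1^n+Bw_2^n+Cw_3^n\big).$$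
   Context: The sequence $r_n=r_n(x)$ is the (first version of the) third-order Pell polynomials of Mahon and Horadam. -}

module Defs where

open import Level using (_⊔_)
import Level
open import Data.Nat using (ℕ; zero; suc)
open import Relation.Nullary using (¬_)
open import Algebra.Bundles using (CommutativeRing)

record Field c ℓ : Set (Level.suc (c ⊔ ℓ)) where
  field
    commutativeRing : CommutativeRing c ℓ
  open CommutativeRing commutativeRing public
  field
    _⁻¹       : Carrier → Carrier
    ⁻¹-inverse : ∀ a → ¬ (a ≈ 0#) → a * (a ⁻¹) ≈ 1#
    0≉1       : ¬ (0# ≈ 1#)

  infix 8 _⁻¹
  infixl 7 _/_

  _/_ : Carrier → Carrier → Carrier
  a / b = a * (b ⁻¹)

  pow : Carrier → ℕ → Carrier
  pow a zero    = 1#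
  pow a (suc n) = pow a n * a

  ι : ℕ → Carrier
  ι zero    = 0#
  ι (suc n) = 1# + ι n

  -- x^(n-1) for n ≥ 0 (an integer exponent; for n = 0 it is x⁻¹)
  powPred : Carrier → ℕ → Carrier
  powPred a zero    = a ⁻¹
  powPred a (suc n) = pow a n

  r : Carrier → ℕ → Carrier
  r x zero                   = 0#
  r x (suc zero)             = 1#
  r x (suc (suc zero))       = ι 2 * x
  r x (suc (suc (suc n)))    = ι 2 * x * r x (suc (suc n)) + r x n

CharZero : ∀ {c ℓ} → Field c ℓ → Set ℓ
CharZero F = ∀ n → ¬ (ι (suc n) ≈ 0#)
  where open Field F

{-# OPTIONS --safe #-}
module Submission where

-- w₁ = 1 − t, w₂ and w₃ are the roots of z³ = 2z² + κ with κ = −(1 − t)²(1 + t):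
-- w₂ and w₃ have sum 1 + t and, as W² = (1 + t)(5 − 3t), product t² − 1, so they are
-- the roots of z² − (1 + t)z + t² − 1, and z³ − 2z² − κ = (z − w₁)(z² − (1 + t)z + t² − 1).
-- Hence Sₙ = A w₁ⁿ + B w₂ⁿ + C w₃ⁿ satisfies Sₙ₊₃ = 2Sₙ₊₂ + κSₙ, and as x³κ = 1 the
-- sequence xⁿ⁻¹Sₙ satisfies the recurrence of rₙ. Both sequences start 0, 1, 2x:
-- after multiplying by 2(1 + 3t), the values S₀ = 0, S₁ = 1, S₂ = 2 only involve
-- w₂ + w₃, w₃ − w₂ = W and w₂w₃.

open import Defs
open import Algebra.Bundles using (CommutativeRing)
open import Data.Nat using (ℕ; zero; suc)
import Data.Nat as ℕ
import Data.Nat.Properties as ℕ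
open import Data.Integer as ℤ using (ℤ; +_; -[1+_]; _⊖_; _◃_)
import Data.Integer.Properties as ℤ
open import Data.Sign as Sign using (Sign)
open import Data.Maybe using (Maybe; just; nothing)
open import Relation.Nullary using (¬_; yes; no)
import Relation.Binary.PropositionalEquality as ≡

module IntegerRingSolver {c ℓ} (R : CommutativeRing c ℓ) where
  open CommutativeRing R
  open import Algebra.Properties.Ring ring using (-0#≈0#; -1*x≈-x; -‿involutive; -‿+-comm)
  open import Algebra.Properties.Semiring.Mult semiring using (_×_; ×-homo-+; ×1-homo-*)
  open import Algebra.Properties.CommutativeSemigroup *-commutativeSemigroup using () renaming (interchange to *-interchange)
  open import Algebra.Properties.CommutativeSemigroup +-commutativeSemigroup using () renaming (interchange to +-interchange)
  open import Algebra.Solver.Ring.AlmostCommutativeRing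
  open import Relation.Binary.Reasoning.Setoid setoid

  private
    sign⟦_⟧ : Sign → Carrier
    sign⟦ Sign.+ ⟧ = 1#
    sign⟦ Sign.- ⟧ = - 1#

    sign⟦⟧-homo-* : ∀ s s′ → sign⟦ s Sign.* s′ ⟧ ≈ sign⟦ s ⟧ * sign⟦ s′ ⟧
    sign⟦⟧-homo-* Sign.- Sign.- = sym (trans (-1*x≈-x (- 1#)) (-‿involutive 1#))
    sign⟦⟧-homo-* Sign.- Sign.+ = sym (*-identityʳ _)
    sign⟦⟧-homo-* Sign.+ _      = sym (*-identityˡ _)

    ⟦_⟧₀ : ℤ → Carrier
    ⟦ + n ⟧₀      = n × 1#
    ⟦ -[1+ n ] ⟧₀ = - (suc n × 1#)

    ⟦⟧₀-sign-abs : ∀ i → ⟦ i ⟧₀ ≈ sign⟦ ℤ.sign i ⟧ * (ℤ.∣ i ∣ × 1#)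
    ⟦⟧₀-sign-abs (+ n)      = sym (*-identityˡ _)
    ⟦⟧₀-sign-abs -[1+ n ] = sym (-1*x≈-x _)

    ⟦◃⟧₀ : ∀ s n → ⟦ s ◃ n ⟧₀ ≈ sign⟦ s ⟧ * (n × 1#)
    ⟦◃⟧₀ s        zero    = sym (zeroʳ _)
    ⟦◃⟧₀ Sign.+ (suc n) = sym (*-identityˡ _)
    ⟦◃⟧₀ Sign.- (suc n) = sym (-1*x≈-x _)

    ⟦⊖⟧₀ : ∀ m n → ⟦ m ⊖ n ⟧₀ ≈ m × 1# - n × 1#
    ⟦⊖⟧₀ m       zero    = sym (trans (+-congˡ -0#≈0#) (+-identityʳ _))
    ⟦⊖⟧₀ zero    (suc n) = sym (+-identityˡ _)
    ⟦⊖⟧₀ (suc m) (suc n) = begin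
      ⟦ suc m ⊖ suc n ⟧₀              ≡⟨ ≡.cong ⟦_⟧₀ (ℤ.[1+m]⊖[1+n]≡m⊖n m n) ⟩
      ⟦ m ⊖ n ⟧₀                      ≈⟨ ⟦⊖⟧₀ m n ⟩
      m × 1# - n × 1#                 ≈⟨ sym (+-identityˡ _) ⟩
      0# + (m × 1# - n × 1#)          ≈⟨ +-congʳ (sym (-‿inverseʳ 1#)) ⟩
      (1# - 1#) + (m × 1# - n × 1#)   ≈⟨ +-interchange 1# (- 1#) (m × 1#) (- (n × 1#)) ⟩
      (1# + m × 1#) + (- 1# - n × 1#) ≈⟨ +-congˡ (-‿+-comm 1# (n × 1#)) ⟩
      (1# + m × 1#) - (1# + n × 1#)   ∎

    ⟦⟧₀-homo-+ : ∀ i j → ⟦ i ℤ.+ j ⟧₀ ≈ ⟦ i ⟧₀ + ⟦ j ⟧₀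
    ⟦⟧₀-homo-+ (+ m)      (+ n)      = ×-homo-+ 1# m n
    ⟦⟧₀-homo-+ (+ m)      -[1+ n ] = ⟦⊖⟧₀ m (suc n)
    ⟦⟧₀-homo-+ -[1+ m ] (+ n)      = trans (⟦⊖⟧₀ n (suc m)) (+-comm _ _)
    ⟦⟧₀-homo-+ -[1+ m ] -[1+ n ] = begin
      - (suc (suc (m ℕ.+ n)) × 1#)        ≡⟨ ≡.cong (λ k → - (suc k × 1#)) (≡.sym (ℕ.+-suc m n)) ⟩
      - ((suc m ℕ.+ suc n) × 1#)          ≈⟨ -‿cong (×-homo-+ 1# (suc m) (suc n)) ⟩
      - (suc m × 1# + suc n × 1#)         ≈⟨ sym (-‿+-comm _ _) ⟩
      - (suc m × 1#) + - (suc n × 1#)     ∎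

    ⟦⟧₀-homo-* : ∀ i j → ⟦ i ℤ.* j ⟧₀ ≈ ⟦ i ⟧₀ * ⟦ j ⟧₀
    ⟦⟧₀-homo-* i j = begin
      ⟦ (ℤ.sign i Sign.* ℤ.sign j) ◃ (ℤ.∣ i ∣ ℕ.* ℤ.∣ j ∣) ⟧₀
        ≈⟨ ⟦◃⟧₀ (ℤ.sign i Sign.* ℤ.sign j) (ℤ.∣ i ∣ ℕ.* ℤ.∣ j ∣) ⟩
      sign⟦ ℤ.sign i Sign.* ℤ.sign j ⟧ * ((ℤ.∣ i ∣ ℕ.* ℤ.∣ j ∣) × 1#)
        ≈⟨ *-cong (sign⟦⟧-homo-* (ℤ.sign i) (ℤ.sign j)) (×1-homo-* ℤ.∣ i ∣ ℤ.∣ j ∣) ⟩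
      (sign⟦ ℤ.sign i ⟧ * sign⟦ ℤ.sign j ⟧) * (ℤ.∣ i ∣ × 1# * ℤ.∣ j ∣ × 1#)
        ≈⟨ *-interchange _ _ _ _ ⟩
      (sign⟦ ℤ.sign i ⟧ * ℤ.∣ i ∣ × 1#) * (sign⟦ ℤ.sign j ⟧ * ℤ.∣ j ∣ × 1#)
        ≈⟨ *-cong (sym (⟦⟧₀-sign-abs i)) (sym (⟦⟧₀-sign-abs j)) ⟩
      ⟦ i ⟧₀ * ⟦ j ⟧₀ ∎

    ⟦⟧₀-homo-- : ∀ i → ⟦ ℤ.- i ⟧₀ ≈ - ⟦ i ⟧₀
    ⟦⟧₀-homo-- (+ zero)  = sym -0#≈0#
    ⟦⟧₀-homo-- (+ suc n) = refl
    ⟦⟧₀-homo-- -[1+ n ]  = sym (-‿involutive _)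

    -- Agrees with ⟦_⟧₀ but sends + 1 to 1# itself, so that con (+ 1) denotes the
    -- 1# of a goal definitionally (as con (+ n) denotes ι n for the other n).
    ⟦_⟧ℤ : ℤ → Carrier
    ⟦ + 1 ⟧ℤ = 1#
    ⟦ i ⟧ℤ   = ⟦ i ⟧₀

    ⟦⟧ℤ≈⟦⟧₀ : ∀ i → ⟦ i ⟧ℤ ≈ ⟦ i ⟧₀
    ⟦⟧ℤ≈⟦⟧₀ (+ zero)          = refl
    ⟦⟧ℤ≈⟦⟧₀ (+ suc zero)      = sym (+-identityʳ _)
    ⟦⟧ℤ≈⟦⟧₀ (+ suc (suc n))   = refl
    ⟦⟧ℤ≈⟦⟧₀ -[1+ n ]          = refl

    homomorphism : ℤ.+-*-rawRing -Raw-AlmostCommutative⟶ fromCommutativeRing R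
    homomorphism = record
      { ⟦_⟧    = ⟦_⟧ℤ
      ; +-homo = λ i j → trans (⟦⟧ℤ≈⟦⟧₀ (i ℤ.+ j)) (trans (⟦⟧₀-homo-+ i j) (+-cong (sym (⟦⟧ℤ≈⟦⟧₀ i)) (sym (⟦⟧ℤ≈⟦⟧₀ j))))
      ; *-homo = λ i j → trans (⟦⟧ℤ≈⟦⟧₀ (i ℤ.* j)) (trans (⟦⟧₀-homo-* i j) (*-cong (sym (⟦⟧ℤ≈⟦⟧₀ i)) (sym (⟦⟧ℤ≈⟦⟧₀ j))))
      ; -‿homo = λ i → trans (⟦⟧ℤ≈⟦⟧₀ (ℤ.- i)) (trans (⟦⟧₀-homo-- i) (-‿cong (sym (⟦⟧ℤ≈⟦⟧₀ i))))
      ; 0-homo = refl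
      ; 1-homo = refl
      }

    equal? : ∀ i j → Maybe (⟦ i ⟧ℤ ≈ ⟦ j ⟧ℤ)
    equal? i j with i ℤ.≟ j
    ... | yes ≡.refl = just refl
    ... | no _       = nothing

  open import Algebra.Solver.Ring ℤ.+-*-rawRing (fromCommutativeRing R) homomorphism equal? public

  #_ : ∀ {n} → ℕ → Polynomial n
  # k = con (+ k)

module FieldProperties {c ℓ} (F : Field c ℓ) where
  open Field F
  open IntegerRingSolver commutativeRing
  open import Relation.Binary.Reasoning.Setoid setoid

  vieta : ∀ {u v s p} → u + v ≈ s → u * v ≈ p → u * u ≈ s * u - p
  vieta {u} {v} {s} {p} u+v≈s uv≈p = begin
    u * u              ≈⟨ solve 2 (λ u v → u :* u := (u :+ v) :* u :- u :* v) refl u v ⟩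
    (u + v) * u - u * v ≈⟨ +-cong (*-congʳ u+v≈s) (-‿cong uv≈p) ⟩
    s * u - p          ∎

  ⁻¹-inverseˡ : ∀ {a} → ¬ a ≈ 0# → a ⁻¹ * a ≈ 1#
  ⁻¹-inverseˡ {a} a≉0 = trans (*-comm _ _) (⁻¹-inverse a a≉0)

  *-cancelˡ : ∀ {a b b′} → ¬ a ≈ 0# → a * b ≈ a * b′ → b ≈ b′
  *-cancelˡ {a} {b} {b′} a≉0 ab≈ab′ = begin
    b                ≈⟨ sym (*-identityˡ b) ⟩
    1# * b           ≈⟨ *-congʳ (sym (⁻¹-inverseˡ a≉0)) ⟩
    a ⁻¹ * a * b     ≈⟨ *-assoc _ _ _ ⟩
    a ⁻¹ * (a * b)   ≈⟨ *-congˡ ab≈ab′ ⟩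
    a ⁻¹ * (a * b′)  ≈⟨ sym (*-assoc _ _ _) ⟩
    a ⁻¹ * a * b′    ≈⟨ *-congʳ (⁻¹-inverseˡ a≉0) ⟩
    1# * b′          ≈⟨ *-identityˡ b′ ⟩
    b′               ∎

  x≉0∧y≉0⇒x*y≉0 : ∀ {a b} → ¬ a ≈ 0# → ¬ b ≈ 0# → ¬ a * b ≈ 0#
  x≉0∧y≉0⇒x*y≉0 {a} {b} a≉0 b≉0 ab≈0 = b≉0 (*-cancelˡ a≉0 (trans ab≈0 (sym (zeroʳ a))))

  b*[a/b]≈a : ∀ {a b} → ¬ b ≈ 0# → b * (a / b) ≈ a
  b*[a/b]≈a {a} {b} b≉0 = begin
    b * (a * b ⁻¹)  ≈⟨ *-congˡ (*-comm a _) ⟩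
    b * (b ⁻¹ * a)  ≈⟨ sym (*-assoc _ _ _) ⟩
    b * b ⁻¹ * a    ≈⟨ *-congʳ (⁻¹-inverse b b≉0) ⟩
    1# * a          ≈⟨ *-identityˡ a ⟩
    a               ∎

  x*y≈z⇒x≈z/y : ∀ {a b c} → ¬ b ≈ 0# → a * b ≈ c → a ≈ c / b
  x*y≈z⇒x≈z/y {a} {b} {c} b≉0 ab≈c =
    *-cancelˡ b≉0 (trans (*-comm b a) (trans ab≈c (sym (b*[a/b]≈a b≉0))))

module ThirdOrderRecurrence {c ℓ} (F : Field c ℓ) where
  open Field F
  open FieldProperties F
  open IntegerRingSolver commutativeRing
  open import Relation.Binary.Reasoning.Setoid setoid

  Recurrence : Carrier → Carrier → (ℕ → Carrier) → Set ℓ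
  Recurrence a b s = ∀ n → s (suc (suc (suc n))) ≈ a * s (suc (suc n)) + b * s n

  Recurrence-congʳ : ∀ {a b b′ s} → b ≈ b′ → Recurrence a b s → Recurrence a b′ s
  Recurrence-congʳ b≈b′ rec n = trans (rec n) (+-congˡ (*-congʳ b≈b′))

  pow-recurrence : ∀ {a b w} → w * w * w ≈ a * (w * w) + b → Recurrence a b (pow w)
  pow-recurrence {a} {b} {w} w-root n = begin
    pow w n * w * w * w          ≈⟨ solve 2 (λ p w → p :* w :* w :* w := p :* (w :* w :* w)) refl (pow w n) w ⟩
    pow w n * (w * w * w)        ≈⟨ *-congˡ w-root ⟩
    pow w n * (a * (w * w) + b)  ≈⟨ solve 4 (λ p w a b → p :* (a :* (w :* w) :+ b) := a :* (p :* w :* w) :+ b :* p) refl (pow w n) w a b ⟩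
    a * (pow w n * w * w) + b * pow w n ∎

  +-recurrence : ∀ {a b s s′} → Recurrence a b s → Recurrence a b s′ →
                 Recurrence a b (λ n → s n + s′ n)
  +-recurrence {a} {b} {s} {s′} rec rec′ n = begin
    s (3 ℕ.+ n) + s′ (3 ℕ.+ n)
      ≈⟨ +-cong (rec n) (rec′ n) ⟩
    (a * s (2 ℕ.+ n) + b * s n) + (a * s′ (2 ℕ.+ n) + b * s′ n)
      ≈⟨ solve 6 (λ a b u v u′ v′ → (a :* u :+ b :* v) :+ (a :* u′ :+ b :* v′) := a :* (u :+ u′) :+ b :* (v :+ v′))
               refl a b (s (2 ℕ.+ n)) (s n) (s′ (2 ℕ.+ n)) (s′ n) ⟩
    a * (s (2 ℕ.+ n) + s′ (2 ℕ.+ n)) + b * (s n + s′ n) ∎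

  *-recurrence : ∀ {a b s} k → Recurrence a b s → Recurrence a b (λ n → k * s n)
  *-recurrence {a} {b} {s} k rec n = begin
    k * s (3 ℕ.+ n)                      ≈⟨ *-congˡ (rec n) ⟩
    k * (a * s (2 ℕ.+ n) + b * s n)      ≈⟨ solve 5 (λ k a b u v → k :* (a :* u :+ b :* v) := a :* (k :* u) :+ b :* (k :* v))
                                                  refl k a b (s (2 ℕ.+ n)) (s n) ⟩
    a * (k * s (2 ℕ.+ n)) + b * (k * s n) ∎

  powPred-+3 : ∀ {x} → ¬ x ≈ 0# → ∀ n → powPred x (3 ℕ.+ n) ≈ pow x 3 * powPred x n
  powPred-+3 {x} x≉0 zero = begin
    1# * x * x                    ≈⟨ sym (*-identityʳ _) ⟩
    1# * x * x * 1#               ≈⟨ *-congˡ (sym (⁻¹-inverse x x≉0)) ⟩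
    1# * x * x * (x * x ⁻¹)       ≈⟨ solve 2 (λ x y → # 1 :* x :* x :* (x :* y) := # 1 :* x :* x :* x :* y) refl x (x ⁻¹) ⟩
    1# * x * x * x * x ⁻¹         ∎
  powPred-+3 {x} x≉0 (suc n) =
    solve 2 (λ x p → p :* x :* x :* x := # 1 :* x :* x :* x :* p) refl x (pow x n)

  powPred-*-recurrence : ∀ {a b s x} → ¬ x ≈ 0# → Recurrence a b s →
                         Recurrence (a * x) (pow x 3 * b) (λ n → powPred x n * s n)
  powPred-*-recurrence {a} {b} {s} {x} x≉0 rec n = begin
    pow x (suc n) * x * s (3 ℕ.+ n)
      ≈⟨ *-congˡ (rec n) ⟩
    pow x (suc n) * x * (a * s (2 ℕ.+ n) + b * s n)
      ≈⟨ solve 6 (λ p x a b u v → p :* x :* (a :* u :+ b :* v) := a :* x :* (p :* u) :+ b :* (p :* x :* v))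
               refl (pow x (suc n)) x a b (s (2 ℕ.+ n)) (s n) ⟩
    a * x * (pow x (suc n) * s (2 ℕ.+ n)) + b * (powPred x (3 ℕ.+ n) * s n)
      ≈⟨ +-congˡ (*-congˡ (*-congʳ (powPred-+3 x≉0 n))) ⟩
    a * x * (pow x (suc n) * s (2 ℕ.+ n)) + b * (pow x 3 * powPred x n * s n)
      ≈⟨ +-congˡ (solve 4 (λ b c p u → b :* (c :* p :* u) := c :* b :* (p :* u)) refl b (pow x 3) (powPred x n) (s n)) ⟩
    a * x * (pow x (suc n) * s (2 ℕ.+ n)) + pow x 3 * b * (powPred x n * s n) ∎

  r-unique : ∀ {x s} → s 0 ≈ 0# → s 1 ≈ 1# → s 2 ≈ ι 2 * x → Recurrence (ι 2 * x) 1# s →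
             ∀ n → r x n ≈ s n
  r-unique s₀ s₁ s₂ rec zero                = sym s₀
  r-unique s₀ s₁ s₂ rec (suc zero)          = sym s₁
  r-unique s₀ s₁ s₂ rec (suc (suc zero))    = sym s₂
  r-unique {x} {s} s₀ s₁ s₂ rec (suc (suc (suc n))) = begin
    ι 2 * x * r x (2 ℕ.+ n) + r x n    ≈⟨ +-cong (*-congˡ (r-unique s₀ s₁ s₂ rec (suc (suc n))))
                                                 (trans (r-unique s₀ s₁ s₂ rec n) (sym (*-identityˡ _))) ⟩
    ι 2 * x * s (2 ℕ.+ n) + 1# * s n   ≈⟨ sym (rec n) ⟩
    s (3 ℕ.+ n)                        ∎

module ThirdOrderPell {c ℓ} (F : Field c ℓ) (charZero : CharZero F) where
  open Field F

  module Binet (t W : Carrier) (W² : W * W ≈ (1# + t) * (ι 5 - ι 3 * t)) where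
    open FieldProperties F
    open IntegerRingSolver commutativeRing
    open ThirdOrderRecurrence F
    open import Algebra.Properties.Group +-group using () renaming (x≈y⇒x∙y⁻¹≈ε to x≈y⇒x-y≈0)
    open import Algebra.Properties.Ring ring using (-‿distribˡ-*; -‿distribʳ-*; -0#≈0#; -‿involutive)
    open import Relation.Binary.Reasoning.Setoid setoid

    w₁ w₂ w₃ κ : Carrier
    w₁ = 1# - t
    w₂ = (1# + t - W) / ι 2
    w₃ = (1# + t + W) / ι 2
    κ  = - (pow (1# - t) 2 * (1# + t))

    cubic-root : ∀ {z} → z * z ≈ (1# + t) * z - (t * t - 1#) → z * z * z ≈ ι 2 * (z * z) + κ
    cubic-root {z} z-root = begin
      z * z * z
        ≈⟨ solve 2 (λ z t → z :* z :* z :=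
                     # 2 :* (z :* z) :+ :- (# 1 :* (# 1 :- t) :* (# 1 :- t) :* (# 1 :+ t))
                     :+ (z :- (# 1 :- t)) :* (z :* z :- ((# 1 :+ t) :* z :- (t :* t :- # 1))))
                 refl z t ⟩
      ι 2 * (z * z) + κ + (z - w₁) * (z * z - ((1# + t) * z - (t * t - 1#)))
        ≈⟨ +-congˡ (trans (*-congˡ (x≈y⇒x-y≈0 z-root)) (zeroʳ _)) ⟩
      ι 2 * (z * z) + κ + 0#
        ≈⟨ +-identityʳ _ ⟩
      ι 2 * (z * z) + κ ∎

    w₁-cubic-root : w₁ * w₁ * w₁ ≈ ι 2 * (w₁ * w₁) + κ
    w₁-cubic-root = solve 1 (λ t → (# 1 :- t) :* (# 1 :- t) :* (# 1 :- t) :=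
                     # 2 :* ((# 1 :- t) :* (# 1 :- t)) :+ :- (# 1 :* (# 1 :- t) :* (# 1 :- t) :* (# 1 :+ t)))
                     refl t

    ι2≉0 : ¬ ι 2 ≈ 0#
    ι2≉0 = charZero 1

    ι2*w₂ : ι 2 * w₂ ≈ 1# + t - W
    ι2*w₂ = b*[a/b]≈a ι2≉0

    ι2*w₃ : ι 2 * w₃ ≈ 1# + t + W
    ι2*w₃ = b*[a/b]≈a ι2≉0

    w₂+w₃≈1+t : w₂ + w₃ ≈ 1# + t
    w₂+w₃≈1+t = *-cancelˡ ι2≉0 (begin
      ι 2 * (w₂ + w₃)              ≈⟨ distribˡ _ _ _ ⟩
      ι 2 * w₂ + ι 2 * w₃          ≈⟨ +-cong ι2*w₂ ι2*w₃ ⟩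
      (1# + t - W) + (1# + t + W)  ≈⟨ solve 2 (λ t W → (# 1 :+ t :- W) :+ (# 1 :+ t :+ W) := # 2 :* (# 1 :+ t)) refl t W ⟩
      ι 2 * (1# + t)               ∎)

    w₃-w₂≈W : w₃ - w₂ ≈ W
    w₃-w₂≈W = *-cancelˡ ι2≉0 (begin
      ι 2 * (w₃ - w₂)              ≈⟨ solve 2 (λ u v → # 2 :* (v :- u) := # 2 :* v :- # 2 :* u) refl w₂ w₃ ⟩
      ι 2 * w₃ - ι 2 * w₂          ≈⟨ +-cong ι2*w₃ (-‿cong ι2*w₂) ⟩
      (1# + t + W) - (1# + t - W)  ≈⟨ solve 2 (λ t W → (# 1 :+ t :+ W) :- (# 1 :+ t :- W) := # 2 :* W) refl t W ⟩
      ι 2 * W                      ∎)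

    w₂*w₃≈t²-1 : w₂ * w₃ ≈ t * t - 1#
    w₂*w₃≈t²-1 = *-cancelˡ (charZero 3) (begin
      ι 4 * (w₂ * w₃)                          ≈⟨ solve 2 (λ u v → # 4 :* (u :* v) := # 2 :* u :* (# 2 :* v)) refl w₂ w₃ ⟩
      ι 2 * w₂ * (ι 2 * w₃)                    ≈⟨ *-cong ι2*w₂ ι2*w₃ ⟩
      (1# + t - W) * (1# + t + W)              ≈⟨ solve 2 (λ t W → (# 1 :+ t :- W) :* (# 1 :+ t :+ W) := (# 1 :+ t) :* (# 1 :+ t) :- W :* W) refl t W ⟩
      (1# + t) * (1# + t) - W * W              ≈⟨ +-congˡ (-‿cong W²) ⟩
      (1# + t) * (1# + t) - (1# + t) * (ι 5 - ι 3 * t)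
                                               ≈⟨ solve 1 (λ t → (# 1 :+ t) :* (# 1 :+ t) :- (# 1 :+ t) :* (# 5 :- # 3 :* t) := # 4 :* (t :* t :- # 1)) refl t ⟩
      ι 4 * (t * t - 1#)                       ∎)

    w₂-cubic-root : w₂ * w₂ * w₂ ≈ ι 2 * (w₂ * w₂) + κ
    w₂-cubic-root = cubic-root (vieta w₂+w₃≈1+t w₂*w₃≈t²-1)

    w₃-cubic-root : w₃ * w₃ * w₃ ≈ ι 2 * (w₃ * w₃) + κ
    w₃-cubic-root = cubic-root (vieta (trans (+-comm w₃ w₂) w₂+w₃≈1+t) (trans (*-comm w₃ w₂) w₂*w₃≈t²-1))

    d e A β γ B C : Carrier
    d = 1# + ι 3 * t
    e = ι 5 - ι 3 * t
    A = - (1# / d)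
    β = 1# / (ι 2 * d)
    γ = (ι 3 / ι 2) * (W / (e * d))
    B = β - γ
    C = β + γ

    S : ℕ → Carrier
    S n = A * pow w₁ n + B * pow w₂ n + C * pow w₃ n

    S-recurrence : Recurrence (ι 2) κ S
    S-recurrence = +-recurrence (+-recurrence (*-recurrence A (pow-recurrence w₁-cubic-root))
                                              (*-recurrence B (pow-recurrence w₂-cubic-root)))
                                (*-recurrence C (pow-recurrence w₃-cubic-root))

    x³κ≈1 : ∀ {x} → pow x 3 * pow (1# - t) 2 * (1# + t) ≈ - 1# → pow x 3 * κ ≈ 1#
    x³κ≈1 {x} x³[1-t]²[1+t]≈-1 = begin
      pow x 3 * - (pow (1# - t) 2 * (1# + t))    ≈⟨ sym (-‿distribʳ-* _ _) ⟩
      - (pow x 3 * (pow (1# - t) 2 * (1# + t)))  ≈⟨ -‿cong (sym (*-assoc _ _ _)) ⟩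
      - (pow x 3 * pow (1# - t) 2 * (1# + t))    ≈⟨ -‿cong x³[1-t]²[1+t]≈-1 ⟩
      - - 1#                                     ≈⟨ -‿involutive 1# ⟩
      1#                                         ∎

    module _ (t≉-1/3 : ¬ t ≈ - (1# / ι 3)) (t≉5/3 : ¬ t ≈ ι 5 / ι 3) where

      d≉0 : ¬ d ≈ 0#
      d≉0 d≈0 = t≉-1/3 (begin
        t                 ≈⟨ x*y≈z⇒x≈z/y (charZero 2) t*3≈-1 ⟩
        - 1# * ι 3 ⁻¹     ≈⟨ sym (-‿distribˡ-* 1# _) ⟩
        - (1# / ι 3)      ∎)
        where
        t*3≈-1 : t * ι 3 ≈ - 1#
        t*3≈-1 = begin
          t * ι 3              ≈⟨ solve 1 (λ t → t :* # 3 := :- # 1 :+ (# 1 :+ # 3 :* t)) refl t ⟩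
          - 1# + d             ≈⟨ +-congˡ d≈0 ⟩
          - 1# + 0#            ≈⟨ +-identityʳ _ ⟩
          - 1#                 ∎

      e≉0 : ¬ e ≈ 0#
      e≉0 e≈0 = t≉5/3 (x*y≈z⇒x≈z/y (charZero 2) (begin
        t * ι 3              ≈⟨ solve 1 (λ t → t :* # 3 := # 5 :- (# 5 :- # 3 :* t)) refl t ⟩
        ι 5 - e              ≈⟨ +-congˡ (-‿cong e≈0) ⟩
        ι 5 - 0#             ≈⟨ +-congˡ -0#≈0# ⟩
        ι 5 + 0#             ≈⟨ +-identityʳ _ ⟩
        ι 5                  ∎))

      d*A≈-1 : d * A ≈ - 1#
      d*A≈-1 = trans (sym (-‿distribʳ-* d _)) (-‿cong (b*[a/b]≈a d≉0))

      d*[2β]≈1 : d * (ι 2 * β) ≈ 1#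
      d*[2β]≈1 = trans (solve 2 (λ d β → d :* (# 2 :* β) := # 2 :* d :* β) refl d β)
                       (b*[a/b]≈a (x≉0∧y≉0⇒x*y≉0 ι2≉0 d≉0))

      d*[2γ]*[w₃-w₂]≈3[1+t] : d * (ι 2 * γ) * (w₃ - w₂) ≈ ι 3 * (1# + t)
      d*[2γ]*[w₃-w₂]≈3[1+t] = begin
        d * (ι 2 * γ) * (w₃ - w₂)
          ≈⟨ *-congˡ w₃-w₂≈W ⟩
        d * (ι 2 * γ) * W
          ≈⟨ solve 4 (λ t W h j → (# 1 :+ # 3 :* t) :* (# 2 :* (# 3 :* h :* (W :* j))) :* W :=
                                   # 3 :* (# 2 :* h) :* (W :* W) :* ((# 1 :+ # 3 :* t) :* j))
                   refl t W (ι 2 ⁻¹) ((e * d) ⁻¹) ⟩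
        ι 3 * (ι 2 * ι 2 ⁻¹) * (W * W) * (d * (e * d) ⁻¹)
          ≈⟨ *-congʳ (*-cong (*-congˡ (⁻¹-inverse (ι 2) ι2≉0)) W²) ⟩
        ι 3 * 1# * ((1# + t) * e) * (d * (e * d) ⁻¹)
          ≈⟨ solve 4 (λ t e d j → # 3 :* # 1 :* ((# 1 :+ t) :* e) :* (d :* j) := # 3 :* (# 1 :+ t) :* (e :* d :* j))
                   refl t e d ((e * d) ⁻¹) ⟩
        ι 3 * (1# + t) * (e * d * (e * d) ⁻¹)
          ≈⟨ *-congˡ (⁻¹-inverse (e * d) (x≉0∧y≉0⇒x*y≉0 e≉0 d≉0)) ⟩
        ι 3 * (1# + t) * 1#
          ≈⟨ *-identityʳ _ ⟩
        ι 3 * (1# + t) ∎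

      cancel-2d : ∀ {u v} → ι 2 * d * u ≈ ι 2 * d * v → u ≈ v
      cancel-2d = *-cancelˡ (x≉0∧y≉0⇒x*y≉0 ι2≉0 d≉0)

      S₀≈0 : S 0 ≈ 0#
      S₀≈0 = cancel-2d (begin
        ι 2 * d * S 0
          ≈⟨ solve 4 (λ d A β γ → # 2 :* d :* (A :* # 1 :+ (β :- γ) :* # 1 :+ (β :+ γ) :* # 1) :=
                                   # 2 :* (d :* A) :+ d :* (# 2 :* β) :* # 2)
                   refl d A β γ ⟩
        ι 2 * (d * A) + d * (ι 2 * β) * ι 2
          ≈⟨ +-cong (*-congˡ d*A≈-1) (*-congʳ d*[2β]≈1) ⟩
        ι 2 * - 1# + 1# * ι 2
          ≈⟨ solve 1 (λ d → # 2 :* :- # 1 :+ # 1 :* # 2 := # 2 :* d :* # 0) refl d ⟩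
        ι 2 * d * 0# ∎)

      S₁≈1 : S 1 ≈ 1#
      S₁≈1 = cancel-2d (begin
        ι 2 * d * S 1
          ≈⟨ solve 7 (λ d A β γ u v w →
                        # 2 :* d :* (A :* (# 1 :* u) :+ (β :- γ) :* (# 1 :* v) :+ (β :+ γ) :* (# 1 :* w)) :=
                        # 2 :* (d :* A) :* u :+ d :* (# 2 :* β) :* (v :+ w) :+ d :* (# 2 :* γ) :* (w :- v))
                   refl d A β γ w₁ w₂ w₃ ⟩
        ι 2 * (d * A) * w₁ + d * (ι 2 * β) * (w₂ + w₃) + d * (ι 2 * γ) * (w₃ - w₂)
          ≈⟨ +-cong (+-cong (*-congʳ (*-congˡ d*A≈-1)) (*-cong d*[2β]≈1 w₂+w₃≈1+t)) d*[2γ]*[w₃-w₂]≈3[1+t] ⟩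
        ι 2 * - 1# * w₁ + 1# * (1# + t) + ι 3 * (1# + t)
          ≈⟨ solve 1 (λ t → # 2 :* :- # 1 :* (# 1 :- t) :+ # 1 :* (# 1 :+ t) :+ # 3 :* (# 1 :+ t) :=
                            # 2 :* (# 1 :+ # 3 :* t) :* # 1)
                   refl t ⟩
        ι 2 * d * 1# ∎)

      S₂≈2 : S 2 ≈ ι 2
      S₂≈2 = cancel-2d (begin
        ι 2 * d * S 2
          ≈⟨ solve 7 (λ d A β γ u v w →
                        # 2 :* d :* (A :* (# 1 :* u :* u) :+ (β :- γ) :* (# 1 :* v :* v) :+ (β :+ γ) :* (# 1 :* w :* w)) :=
                        # 2 :* (d :* A) :* (u :* u) :+ d :* (# 2 :* β) :* ((v :+ w) :* (v :+ w) :- # 2 :* (v :* w))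
                        :+ d :* (# 2 :* γ) :* (w :- v) :* (v :+ w))
                   refl d A β γ w₁ w₂ w₃ ⟩
        ι 2 * (d * A) * (w₁ * w₁) + d * (ι 2 * β) * ((w₂ + w₃) * (w₂ + w₃) - ι 2 * (w₂ * w₃))
          + d * (ι 2 * γ) * (w₃ - w₂) * (w₂ + w₃)
          ≈⟨ +-cong (+-cong (*-congʳ (*-congˡ d*A≈-1))
                            (*-cong d*[2β]≈1 (+-cong (*-cong w₂+w₃≈1+t w₂+w₃≈1+t) (-‿cong (*-congˡ w₂*w₃≈t²-1)))))
                    (*-cong d*[2γ]*[w₃-w₂]≈3[1+t] w₂+w₃≈1+t) ⟩
        ι 2 * - 1# * (w₁ * w₁) + 1# * ((1# + t) * (1# + t) - ι 2 * (t * t - 1#)) + ι 3 * (1# + t) * (1# + t)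
          ≈⟨ solve 1 (λ t → # 2 :* :- # 1 :* ((# 1 :- t) :* (# 1 :- t))
                            :+ # 1 :* ((# 1 :+ t) :* (# 1 :+ t) :- # 2 :* (t :* t :- # 1))
                            :+ # 3 :* (# 1 :+ t) :* (# 1 :+ t) :=
                            # 2 :* (# 1 :+ # 3 :* t) :* # 2)
                   refl t ⟩
        ι 2 * d * ι 2 ∎)

mainTheorem1 : ∀ {c ℓ} (F : Field c ℓ) → CharZero F →
    let open Field F in
    ∀ (x t W : Carrier) →
    ¬ (x ≈ 0#) →
    pow x 3 * pow (1# - t) 2 * (1# + t) ≈ - 1# →
    ¬ (t ≈ - (1# / ι 3)) →
    ¬ (t ≈ ι 5 / ι 3) →
    W * W ≈ (1# + t) * (ι 5 - ι 3 * t) →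
    let w₁ = 1# - t
        w₂ = (1# + t - W) / ι 2
        w₃ = (1# + t + W) / ι 2
        A  = - (1# / (1# + ι 3 * t))
        B  = 1# / (ι 2 * (1# + ι 3 * t))
             - (ι 3 / ι 2) * (W / ((ι 5 - ι 3 * t) * (1# + ι 3 * t)))
        C  = 1# / (ι 2 * (1# + ι 3 * t))
             + (ι 3 / ι 2) * (W / ((ι 5 - ι 3 * t) * (1# + ι 3 * t)))
    in ∀ (n : ℕ) →
       r x n ≈ powPred x n * (A * pow w₁ n + B * pow w₂ n + C * pow w₃ n)
mainTheorem1 F charZero x t W x≉0 x³[1-t]²[1+t]≈-1 t≉-1/3 t≉5/3 W² =
  r-unique initial₀ initial₁ initial₂ recurrence
  where
  open Field F
  open ThirdOrderRecurrence F
  open ThirdOrderPell.Binet F charZero t W W²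

  recurrence : Recurrence (ι 2 * x) 1# (λ n → powPred x n * S n)
  recurrence = Recurrence-congʳ (x³κ≈1 x³[1-t]²[1+t]≈-1) (powPred-*-recurrence x≉0 S-recurrence)

  initial₀ : x ⁻¹ * S 0 ≈ 0#
  initial₀ = trans (*-congˡ (S₀≈0 t≉-1/3 t≉5/3)) (zeroʳ _)

  initial₁ : 1# * S 1 ≈ 1#
  initial₁ = trans (*-identityˡ _) (S₁≈1 t≉-1/3 t≉5/3)

  initial₂ : 1# * x * S 2 ≈ ι 2 * x
  initial₂ = trans (*-cong (*-identityˡ x) (S₂≈2 t≉-1/3 t≉5/3)) (*-comm x (ι 2))
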